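{- If $G$ is a unicyclic graph that is not a König–Egerváry graph, and $C$ is its unique cycle, then no vertex of $C$ belongs to $N[\mathrm{core}(G)]$.
   Context: All graphs are finite, simple and undirected. A graph is unicyclic if it is connected and contains exactly one cycle. $\alpha(G)$ is the maximum cardinality of an independent set (a set of pairwise non-adjacent vertices) of $G$, and $\mu(G)$ is the maximum cardinality of a matching of $G$. A graph $G$ on $n$ vertices is a König–Egerváry graph if $\alpha(G)+\mu(G)=n$. $\mathrm{core}(G)$ is the intersection of all maximum independent sets of $G$. For $A\subseteq V(G)$, $N(A)$ is the set of vertices adjacent to some vertex of $A$, and $N[A]=A\cup N(A)$. -}

module Defs where

open import Data.Nat using (ℕ; _+_; _≤_)
open import Data.Fin using (Fin)
open import Data.Fin.Subset using (Subset; _∈_; _∉_; ∣_∣)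
open import Data.Bool using (Bool; true; false; T)
open import Data.List using (List; []; _∷_; _++_; [_]; length; concatMap)
open import Data.List.Relation.Unary.Unique.Propositional using (Unique)
open import Data.List.Relation.Unary.Any using (Any)
open import Data.List.Relation.Unary.Linked using (Linked)
open import Data.Product using (_×_; Σ; ∃; _,_; ∃-syntax)
open import Data.Sum using (_⊎_)
open import Relation.Binary.PropositionalEquality using (_≡_)
open import Relation.Nullary using (¬_)
open import Data.Empty using (⊥)

record Graph (n : ℕ) : Set where
  field
    adj    : Fin n → Fin n → Bool
    sym    : ∀ u v → adj u v ≡ adj v u
    irrefl : ∀ v → adj v v ≡ false

open Graph public

module _ {n : ℕ} (G : Graph n) where

  Adj : Fin n → Fin n → Set
  Adj u v = T (adj G u v)

  data Reach : Fin n → Fin n → Set where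
    here : ∀ {v} → Reach v v
    step : ∀ {u w v} → Adj u w → Reach w v → Reach u v

  Connected : Set
  Connected = ∀ u v → Reach u v

  -- A cycle is given by a list  v₀ ∷ … ∷ v_{k-1}  of k ≥ 3 distinct vertices
  -- with v_i ~ v_{i+1} and v_{k-1} ~ v₀.
  record Cycle : Set where
    constructor cycle
    field
      start  : Fin n
      rest   : List (Fin n)
      long   : 3 ≤ length (start ∷ rest)
      unique : Unique (start ∷ rest)
      closed : Linked Adj ((start ∷ rest) ++ [ start ])

  cycleVertices : Cycle → List (Fin n)
  cycleVertices c = Cycle.start c ∷ Cycle.rest c

  OnCycle : Cycle → Fin n → Set
  OnCycle c v = Any (v ≡_) (cycleVertices c)

  Consec : List (Fin n) → Fin n → Fin n → Set
  Consec [] u v = ⊥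
  Consec (x ∷ []) u v = Consec [] u v
  Consec (x ∷ y ∷ xs) u v = ((x ≡ u × y ≡ v) ⊎ (x ≡ v × y ≡ u)) ⊎ Consec (y ∷ xs) u v

  CycleEdge : Cycle → Fin n → Fin n → Set
  CycleEdge c = Consec (cycleVertices c ++ [ Cycle.start c ])

  -- two cycles are the same subgraph iff they have the same edge set
  SameCycle : Cycle → Cycle → Set
  SameCycle c d = ∀ u v → (CycleEdge c u v → CycleEdge d u v) × (CycleEdge d u v → CycleEdge c u v)

  Unicyclic : Set
  Unicyclic = Connected × Σ Cycle (λ c → ∀ d → SameCycle c d)

  Independent : Subset n → Set
  Independent S = ∀ u v → u ∈ S → v ∈ S → ¬ Adj u v

  MaxIndependent : Subset n → Set
  MaxIndependent S = Independent S × (∀ T → Independent T → ∣ T ∣ ≤ ∣ S ∣)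

  endpoints : List (Fin n × Fin n) → List (Fin n)
  endpoints [] = []
  endpoints ((u , v) ∷ M) = u ∷ v ∷ endpoints M

  Matching : List (Fin n × Fin n) → Set
  Matching M = Data.List.Relation.Unary.All.All (λ e → Adj (Data.Product.proj₁ e) (Data.Product.proj₂ e)) M
               × Unique (endpoints M)
    where import Data.List.Relation.Unary.All
          import Data.Product

  MaxMatching : List (Fin n × Fin n) → Set
  MaxMatching M = Matching M × (∀ M' → Matching M' → length M' ≤ length M)

  KonigEgervary : Set
  KonigEgervary = Σ (Subset n) λ S → Σ (List (Fin n × Fin n)) λ M →
                  MaxIndependent S × MaxMatching M × ∣ S ∣ + length M ≡ n

  InCore : Fin n → Set
  InCore v = ∀ S → MaxIndependent S → v ∈ S

  InClosedNbhdCore : Fin n → Set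
  InClosedNbhdCore v = InCore v ⊎ ∃[ u ] (InCore u × Adj u v)

module Submission where

-- Let v lie on the unique cycle C and let vy be the edge of C leaving v.
-- G - vy has no cycle, and graphs without cycles are König–Egerváry:
-- peeling off isolated vertices, or pendant vertices with their neighbour,
-- yields an independent set S of G - vy and a matching M with ∣S∣ + ∣M∣ = n.
-- M is a matching of G; as G is not König–Egerváry, weak duality α + μ ≤ n
-- is strict, so every independent set of G is smaller than S.  Hence v, y ∈ S
-- and S - v, S - y are maximum independent sets of G: the first misses v,
-- the second contains v and so no neighbour of v.

open import Data.Nat using (ℕ; zero; suc; _+_; _≤_; _<_; z≤n; s≤s; s≤s⁻¹)
open import Data.Nat.Properties
  using (+-suc; +-comm; +-identityʳ; +-monoˡ-≤; +-cancelʳ-≤; +-cancelˡ-≤; m≤n⇒m≤1+n; ≤∧≢⇒<;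
         <-trans; <⇒≱; n<1+n; module ≤-Reasoning)
open import Data.Nat.Induction using (<-wellFounded)
open import Induction.WellFounded using (Acc; acc)
open import Data.Bool using (T; _∧_; not)
open import Data.Bool.Properties using (T?; T-∧; T-not-≡)
open import Data.Fin using (Fin; zero; suc; _≟_)
open import Data.Fin.Properties using (any?)
open import Data.Fin.Subset using (Subset; _∈_; _∉_; _⊆_; ∣_∣; inside; outside; ⁅_⁆; _∪_; _-_; ⊥; ⊤; Empty)
open import Data.Fin.Subset.Properties
  using (_∈?_; nonempty?; ∣p∣≤n; ∣⊥∣≡0; ∣⊤∣≡n; ∉⊥; ⊆-min; Empty-unique; p─⊥≡p; p─q⊆p;
         ∪-identityˡ; x∈p∪q⁻; x∈⁅y⁆⇒x≡y; x∈p∧x≢y⇒x∈p-y; x∈p⇒∣p-x∣<∣p∣)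
open import Data.Vec using (_∷_; here; there)
open import Data.List using (List; []; _∷_; [_]; _++_; length; filter)
open import Data.List.Membership.Propositional using () renaming (_∈_ to _∈ₗ_)
open import Data.List.Relation.Unary.All as All using (All; []; _∷_)
open import Data.List.Relation.Unary.All.Properties using (all-filter; ¬Any⇒All¬)
open import Data.List.Relation.Unary.Any using (Any; here; there)
open import Data.List.Relation.Unary.AllPairs using ([]; _∷_)
open import Data.List.Relation.Unary.Linked as Linked using (Linked; []; [-]; _∷_)
open import Data.List.Relation.Unary.Unique.Propositional using (Unique)
import Data.List.Relation.Unary.Unique.Propositional.Properties as Unique
open import Data.Product as Product using (_×_; _,_; proj₁; proj₂; uncurry; ∃-syntax)
open import Data.Sum as Sum using (_⊎_; inj₁; inj₂)
open import Data.Empty using (⊥-elim)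
open import Function using (_∘_)
open import Function.Bundles using (mk⇔; Equivalence)
open import Relation.Binary.PropositionalEquality
  using (_≡_; _≢_; refl; cong; cong₂; subst; sym; trans; module ≡-Reasoning)
open import Relation.Nullary using (¬_; Dec; yes; no; ¬?; contradiction)
open import Relation.Nullary.Decidable
  using (_×-dec_; _⊎-dec_; does; does-⇔; dec-true; dec-false; decidable-stable)
open import Defs renaming (sym to adj-sym)

private variable
  n : ℕ

∣p-x∣+1≡∣p∣ : ∀ {x : Fin n} {p} → x ∈ p → suc ∣ p - x ∣ ≡ ∣ p ∣
∣p-x∣+1≡∣p∣ {p = inside ∷ p}  here        = cong (suc ∘ ∣_∣) (p─⊥≡p p)
∣p-x∣+1≡∣p∣ {p = inside ∷ p}  (there x∈p) = cong suc (∣p-x∣+1≡∣p∣ x∈p)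
∣p-x∣+1≡∣p∣ {p = outside ∷ p} (there x∈p) = ∣p-x∣+1≡∣p∣ x∈p

x∉p-x : ∀ (p : Subset n) x → x ∉ p - x
x∉p-x (_ ∷ p) zero    ()
x∉p-x (_ ∷ p) (suc x) (there x∈p-x) = x∉p-x p x x∈p-x

p-x⊆p : ∀ (p : Subset n) x → p - x ⊆ p
p-x⊆p p x = p─q⊆p p ⁅ x ⁆

∣⁅x⁆∪p∣≡1+∣p∣ : ∀ {x : Fin n} {p} → x ∉ p → ∣ ⁅ x ⁆ ∪ p ∣ ≡ suc ∣ p ∣
∣⁅x⁆∪p∣≡1+∣p∣ {x = zero}  {outside ∷ p} x∉p = cong (suc ∘ ∣_∣) (∪-identityˡ p)
∣⁅x⁆∪p∣≡1+∣p∣ {x = zero}  {inside ∷ p}  x∉p = contradiction here x∉p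
∣⁅x⁆∪p∣≡1+∣p∣ {x = suc x} {outside ∷ p} x∉p = ∣⁅x⁆∪p∣≡1+∣p∣ (x∉p ∘ there)
∣⁅x⁆∪p∣≡1+∣p∣ {x = suc x} {inside ∷ p}  x∉p = cong suc (∣⁅x⁆∪p∣≡1+∣p∣ (x∉p ∘ there))

insert-⊆ : ∀ {p q : Subset n} {x} → x ∈ q → p ⊆ q → ⁅ x ⁆ ∪ p ⊆ q
insert-⊆ {p = p} {x = x} x∈q p⊆q y∈ with x∈p∪q⁻ ⁅ x ⁆ p y∈
... | inj₁ y∈⁅x⁆ rewrite x∈⁅y⁆⇒x≡y x y∈⁅x⁆ = x∈q
... | inj₂ y∈p = p⊆q y∈p

-- A duplicate-free list of elements of Fin n avoiding p has at most
-- n ∸ ∣p∣ entries (induction: move the head of the list into p).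
length-avoiding : ∀ {p : Subset n} {xs} → Unique xs → All (_∉ p) xs → length xs + ∣ p ∣ ≤ n
length-avoiding {p = p} [] [] = ∣p∣≤n p
length-avoiding {n} {p} {x ∷ xs} (x∉xs ∷ distinct) (x∉p ∷ avoid) =
  subst (_≤ n) (+-suc (length xs) ∣ p ∣)
    (subst (λ k → length xs + k ≤ n) (∣⁅x⁆∪p∣≡1+∣p∣ x∉p)
      (length-avoiding distinct (All.zipWith (uncurry avoidBoth) (x∉xs , avoid))))
  where
  avoidBoth : ∀ {y} → x ≢ y → y ∉ p → y ∉ ⁅ x ⁆ ∪ p
  avoidBoth x≢y y∉p y∈ with x∈p∪q⁻ ⁅ x ⁆ p y∈
  ... | inj₁ y∈⁅x⁆ = x≢y (sym (x∈⁅y⁆⇒x≡y x y∈⁅x⁆))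
  ... | inj₂ y∈p   = y∉p y∈p

length-distinct : ∀ {xs : List (Fin n)} → Unique xs → length xs ≤ n
length-distinct {n} {xs} distinct =
  subst (_≤ n) (trans (cong (length xs +_) (∣⊥∣≡0 n)) (+-identityʳ (length xs)))
    (length-avoiding distinct (All.tabulate (λ _ → ∉⊥)))

_∉?_ : ∀ (x : Fin n) p → Dec (x ∉ p)
x ∉? p = ¬? (x ∈? p)

module _ {A : Set} where

  prefixTo : ∀ {x : A} {ys} → x ∈ₗ ys → List A
  prefixTo {ys = y ∷ _} (here _)  = [ y ]
  prefixTo {ys = y ∷ _} (there i) = y ∷ prefixTo i

  prefixTo-nonempty : ∀ {x : A} {ys} (i : x ∈ₗ ys) → 1 ≤ length (prefixTo i)
  prefixTo-nonempty (here _)  = s≤s z≤n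
  prefixTo-nonempty (there _) = s≤s z≤n

  All-prefixTo : ∀ {P : A → Set} {x ys} → All P ys → (i : x ∈ₗ ys) → All P (prefixTo i)
  All-prefixTo (p ∷ _)  (here _)  = p ∷ []
  All-prefixTo (p ∷ ps) (there i) = p ∷ All-prefixTo ps i

  Unique-prefixTo : ∀ {x : A} {ys} → Unique ys → (i : x ∈ₗ ys) → Unique (prefixTo i)
  Unique-prefixTo (_ ∷ _)          (here _)  = [] ∷ []
  Unique-prefixTo (y∉ys ∷ distinct) (there i) = All-prefixTo y∉ys i ∷ Unique-prefixTo distinct i

  Linked-prefixTo : ∀ {R : A → A → Set} {a x w ys} → Linked R (a ∷ ys) → (i : x ∈ₗ ys) → R x w →
                    Linked R ((a ∷ prefixTo i) ++ [ w ])
  Linked-prefixTo (r ∷ _)      (here refl) xw = r ∷ xw ∷ [-]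
  Linked-prefixTo (r ∷ linked) (there i)   xw = r ∷ Linked-prefixTo linked i xw

module _ {n : ℕ} (G : Graph n) where

  Adj-sym : ∀ {a b} → Adj G a b → Adj G b a
  Adj-sym {a} {b} = subst T (adj-sym G a b)

  Adj-irrefl : ∀ {a} → ¬ Adj G a a
  Adj-irrefl {a} = subst T (irrefl G a)

  independent-⊆ : ∀ {S S′} → S′ ⊆ S → Independent G S → Independent G S′
  independent-⊆ S′⊆S ind a b a∈ b∈ = ind a b (S′⊆S a∈) (S′⊆S b∈)

  insert-independent : ∀ {S w} → Independent G S → (∀ x → x ∈ S → ¬ Adj G w x) →
                       Independent G (⁅ w ⁆ ∪ S)
  insert-independent {S} {w} ind noNeighbour a b a∈ b∈ with x∈p∪q⁻ ⁅ w ⁆ S a∈ | x∈p∪q⁻ ⁅ w ⁆ S b∈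
  ... | inj₁ a∈w | inj₁ b∈w rewrite x∈⁅y⁆⇒x≡y w a∈w | x∈⁅y⁆⇒x≡y w b∈w = Adj-irrefl
  ... | inj₁ a∈w | inj₂ b∈S rewrite x∈⁅y⁆⇒x≡y w a∈w = noNeighbour b b∈S
  ... | inj₂ a∈S | inj₁ b∈w rewrite x∈⁅y⁆⇒x≡y w b∈w = noNeighbour a a∈S ∘ Adj-sym
  ... | inj₂ a∈S | inj₂ b∈S = ind a b a∈S b∈S

  matching-of-subgraph : ∀ {H : Graph n} {M} → (∀ {a b} → Adj H a b → Adj G a b) →
                         Matching H M → Matching G M
  matching-of-subgraph {H} {M} H⊆G (edges , distinct) =
    All.map H⊆G edges , subst Unique (same-endpoints M) distinct
    where
    same-endpoints : ∀ M → endpoints H M ≡ endpoints G M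
    same-endpoints []            = refl
    same-endpoints ((a , b) ∷ M) = cong (λ es → a ∷ b ∷ es) (same-endpoints M)

  -- No edge has both endpoints in an independent set T, so each edge of a
  -- matching contributes an endpoint outside T.
  matched-outside : ∀ {T} M → Independent G T → All (λ e → Adj G (proj₁ e) (proj₂ e)) M →
                    length M ≤ length (filter (_∉? T) (endpoints G M))
  matched-outside [] _ [] = z≤n
  matched-outside {T} ((a , b) ∷ M) ind (ab ∷ edges) with a ∈? T
  ... | yes a∈T with b ∈? T
  ...   | yes b∈T = contradiction ab (ind a b a∈T b∈T)
  ...   | no _    = s≤s (matched-outside M ind edges)
  matched-outside {T} ((a , b) ∷ M) ind (ab ∷ edges) | no _ with b ∈? T
  ...   | yes _ = s≤s (matched-outside M ind edges)
  ...   | no _  = s≤s (m≤n⇒m≤1+n (matched-outside M ind edges))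

  -- Weak duality, α(G) + μ(G) ≤ n: the endpoints of M outside T are at
  -- least ∣M∣ distinct vertices, none of them in T.
  weak-duality : ∀ {T M} → Independent G T → Matching G M → ∣ T ∣ + length M ≤ n
  weak-duality {T} {M} ind (edges , distinct) = begin
    ∣ T ∣ + length M                 ≡⟨ +-comm ∣ T ∣ (length M) ⟩
    length M + ∣ T ∣                 ≤⟨ +-monoˡ-≤ ∣ T ∣ (matched-outside M ind edges) ⟩
    length outsideEndpoints + ∣ T ∣  ≤⟨ length-avoiding (Unique.filter⁺ (_∉? T) distinct)
                                                         (all-filter (_∉? T) (endpoints G M)) ⟩
    n                                ∎
    where
    open ≤-Reasoning
    outsideEndpoints : List (Fin n)
    outsideEndpoints = filter (_∉? T) (endpoints G M)

  -- By weak duality, an independent set and a matching that together fill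
  -- n are both maximum, so they witness the König–Egerváry property.
  konig-egervary-witness : ∀ {T M} → Independent G T → Matching G M → ∣ T ∣ + length M ≡ n →
                           KonigEgervary G
  konig-egervary-witness {T} {M} ind mat fill = T , M , (ind , maxT) , (mat , maxM) , fill
    where
    maxT : ∀ T′ → Independent G T′ → ∣ T′ ∣ ≤ ∣ T ∣
    maxT T′ ind′ = +-cancelʳ-≤ (length M) ∣ T′ ∣ ∣ T ∣
                     (subst (∣ T′ ∣ + length M ≤_) (sym fill) (weak-duality ind′ mat))
    maxM : ∀ M′ → Matching G M′ → length M′ ≤ length M
    maxM M′ mat′ = +-cancelˡ-≤ ∣ T ∣ (length M′) (length M)
                     (subst (∣ T ∣ + length M′ ≤_) (sym fill) (weak-duality ind mat′))

  strict-weak-duality : ¬ KonigEgervary G → ∀ {T M} → Independent G T → Matching G M →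
                        ∣ T ∣ + length M < n
  strict-weak-duality notKE ind mat =
    ≤∧≢⇒< (weak-duality ind mat) (notKE ∘ konig-egervary-witness ind mat)

  one-below-is-maximum : ¬ KonigEgervary G → ∀ {S S′ : Subset n} {M} → Matching G M →
                         ∣ S ∣ + length M ≡ n → Independent G S′ → suc ∣ S′ ∣ ≡ ∣ S ∣ →
                         MaxIndependent G S′
  one-below-is-maximum notKE {S} {S′} {M} mat fill ind′ shrink = ind′ , λ T indT →
    s≤s⁻¹ (+-cancelʳ-≤ (length M) (suc ∣ T ∣) (suc ∣ S′ ∣)
      (subst (suc (∣ T ∣ + length M) ≤_) (trans (sym fill) (cong (_+ length M) (sym shrink)))
        (strict-weak-duality notKE indT mat)))

module _ {n : ℕ} (G : Graph n) where

  record Decomposition (W : Subset n) : Set where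
    field
      S           : Subset n
      M           : List (Fin n × Fin n)
      S⊆W         : S ⊆ W
      independent : Independent G S
      matching    : Matching G M
      matched⊆W   : All (_∈ W) (endpoints G M)
      covers      : ∣ S ∣ + length M ≡ ∣ W ∣

  empty-decomposition : ∀ {W} → Empty W → Decomposition W
  empty-decomposition {W} empty = record
    { S = ⊥ {n} ; M = [] ; S⊆W = ⊆-min W ; independent = λ _ _ a∈⊥ → contradiction a∈⊥ ∉⊥
    ; matching = [] , [] ; matched⊆W = []
    ; covers = trans (+-identityʳ ∣ ⊥ {n} ∣) (cong ∣_∣ (sym (Empty-unique empty))) }

  extend-isolated : ∀ {W w} → w ∈ W → (∀ x → x ∈ W → ¬ Adj G w x) →
                    Decomposition (W - w) → Decomposition W
  extend-isolated {W} {w} w∈W noNeighbour D = record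
    { S = ⁅ w ⁆ ∪ S ; M = M
    ; S⊆W = insert-⊆ w∈W (p-x⊆p W w ∘ S⊆W)
    ; independent = insert-independent G independent λ x → noNeighbour x ∘ p-x⊆p W w ∘ S⊆W
    ; matching = matching ; matched⊆W = All.map (p-x⊆p W w) matched⊆W
    ; covers = begin
        ∣ ⁅ w ⁆ ∪ S ∣ + length M  ≡⟨ cong (_+ length M) (∣⁅x⁆∪p∣≡1+∣p∣ (x∉p-x W w ∘ S⊆W)) ⟩
        suc (∣ S ∣ + length M)    ≡⟨ cong suc covers ⟩
        suc ∣ W - w ∣             ≡⟨ ∣p-x∣+1≡∣p∣ w∈W ⟩
        ∣ W ∣                     ∎ }
    where
    open Decomposition D
    open ≡-Reasoning

  neighbour-survives : ∀ {W w w′} → Adj G w w′ → w′ ∈ W → w′ ∈ W - w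
  neighbour-survives ww′ w′∈W = x∈p∧x≢y⇒x∈p-y w′∈W λ { refl → Adj-irrefl G ww′ }

  extend-pendant : ∀ {W w w′} → w ∈ W → w′ ∈ W → Adj G w w′ → (∀ x → x ∈ W → Adj G w x → x ≡ w′) →
                   Decomposition (W - w - w′) → Decomposition W
  extend-pendant {W} {w} {w′} w∈W w′∈W ww′ onlyNeighbour D = record
    { S = ⁅ w ⁆ ∪ S ; M = (w , w′) ∷ M
    ; S⊆W = insert-⊆ w∈W (W″⊆W ∘ S⊆W)
    ; independent = insert-independent G independent notAdjacent
    ; matching = (ww′ ∷ proj₁ matching) ,
                 ((w≢w′ ∷ avoids w∉W″) ∷ avoids w′∉W″ ∷ proj₂ matching)
    ; matched⊆W = w∈W ∷ w′∈W ∷ All.map W″⊆W matched⊆W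
    ; covers = begin
        ∣ ⁅ w ⁆ ∪ S ∣ + suc (length M)  ≡⟨ cong (_+ suc (length M)) (∣⁅x⁆∪p∣≡1+∣p∣ (w∉W″ ∘ S⊆W)) ⟩
        suc (∣ S ∣ + suc (length M))    ≡⟨ cong suc (+-suc ∣ S ∣ (length M)) ⟩
        suc (suc (∣ S ∣ + length M))    ≡⟨ cong (λ k → suc (suc k)) covers ⟩
        suc (suc ∣ W″ ∣)                ≡⟨ cong suc (∣p-x∣+1≡∣p∣ (neighbour-survives ww′ w′∈W)) ⟩
        suc ∣ W - w ∣                   ≡⟨ ∣p-x∣+1≡∣p∣ w∈W ⟩
        ∣ W ∣                           ∎ }
    where
    open Decomposition D
    open ≡-Reasoning
    W″ = W - w - w′
    W″⊆W : W″ ⊆ W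
    W″⊆W = p-x⊆p W w ∘ p-x⊆p (W - w) w′
    w≢w′ : w ≢ w′
    w≢w′ refl = Adj-irrefl G ww′
    w∉W″ : w ∉ W″
    w∉W″ = x∉p-x W w ∘ p-x⊆p (W - w) w′
    w′∉W″ : w′ ∉ W″
    w′∉W″ = x∉p-x (W - w) w′
    avoids : ∀ {z} → z ∉ W″ → All (z ≢_) (endpoints G M)
    avoids z∉W″ = All.map (λ y∈W″ z≡y → z∉W″ (subst (_∈ W″) (sym z≡y) y∈W″)) matched⊆W
    notAdjacent : ∀ x → x ∈ S → ¬ Adj G w x
    notAdjacent x x∈S wx = w′∉W″ (subst (_∈ W″) (onlyNeighbour x (W″⊆W (S⊆W x∈S)) wx) (S⊆W x∈S))

  data Leaf (W : Subset n) : Set where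
    isolated : ∀ w → w ∈ W → (∀ x → x ∈ W → ¬ Adj G w x) → Leaf W
    pendant  : ∀ w w′ → w ∈ W → w′ ∈ W → Adj G w w′ →
               (∀ x → x ∈ W → Adj G w x → x ≡ w′) → Leaf W

  -- A path inside W, listed from its last vertex backwards.
  record Path (W : Subset n) : Set where
    constructor path
    field
      last     : Fin n
      earlier  : List (Fin n)
      distinct : Unique (last ∷ earlier)
      linked   : Linked (Adj G) (last ∷ earlier)
      within   : All (_∈ W) (last ∷ earlier)

    vertices : List (Fin n)
    vertices = last ∷ earlier

  open Path

  chord-cycle : ∀ {w w₁ x ys} → Unique (w ∷ w₁ ∷ ys) → Linked (Adj G) (w ∷ w₁ ∷ ys) →
                x ∈ₗ ys → Adj G w x → Cycle G
  chord-cycle {w} {w₁} (w∉ ∷ distinct) linked x∈ys wx =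
    cycle w (w₁ ∷ prefixTo x∈ys)
      (s≤s (s≤s (prefixTo-nonempty x∈ys)))
      (All-prefixTo w∉ (there x∈ys) ∷ Unique-prefixTo distinct (there x∈ys))
      (Linked-prefixTo linked (there x∈ys) (Adj-sym G wx))

  module _ (acyclic : ¬ Cycle G) where

    open import Data.List.Membership.DecPropositional (_≟_ {n}) using () renaming (_∈?_ to _∈ₗ?_)

    -- If every W-neighbour of the last vertex of a path lies on the path,
    -- then, as there is no cycle, only its predecessor can be one.
    blocked-path-leaf : ∀ {W} (p : Path W) → (∀ x → x ∈ W → Adj G (last p) x → x ∈ₗ vertices p) →
                        Leaf W
    blocked-path-leaf {W} (path w [] _ _ (w∈W ∷ [])) onPath = isolated w w∈W noNeighbour
      where
      noNeighbour : ∀ x → x ∈ W → ¬ Adj G w x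
      noNeighbour x x∈W wx with onPath x x∈W wx
      ... | here refl = Adj-irrefl G wx
    blocked-path-leaf {W} (path w (w₁ ∷ ys) distinct linked (w∈W ∷ w₁∈W ∷ _)) onPath
      with any? (λ x → T? (adj G w x) ×-dec (x ∈ₗ? ys))
    ... | yes (x , wx , x∈ys) = ⊥-elim (acyclic (chord-cycle distinct linked x∈ys wx))
    ... | no noChord = pendant w w₁ w∈W w₁∈W (Linked.head linked) onlyNeighbour
      where
      onlyNeighbour : ∀ x → x ∈ W → Adj G w x → x ≡ w₁
      onlyNeighbour x x∈W wx with onPath x x∈W wx
      ... | here refl          = contradiction wx (Adj-irrefl G)
      ... | there (here x≡w₁)  = x≡w₁
      ... | there (there x∈ys) = contradiction (x , wx , x∈ys) noChord

    -- Extend the path while its last vertex has a neighbour in W off the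
    -- path; a path has at most n vertices, so the fuel never runs out.
    walk : ∀ {W} fuel (p : Path W) → n < length (vertices p) + fuel → Leaf W
    walk zero p long =
      contradiction (subst (_≤ n) (sym (+-identityʳ _)) (length-distinct (distinct p))) (<⇒≱ long)
    walk {W} (suc fuel) p long
      with any? (λ x → x ∈? W ×-dec T? (adj G (last p) x) ×-dec ¬? (x ∈ₗ? vertices p))
    ... | yes (x , x∈W , wx , x∉p) =
      walk fuel (path x (vertices p) (¬Any⇒All¬ _ x∉p ∷ distinct p) (Adj-sym G wx ∷ linked p) (x∈W ∷ within p))
           (subst (n <_) (+-suc (length (vertices p)) fuel) long)
    ... | no blocked = blocked-path-leaf p λ x x∈W wx →
      decidable-stable (x ∈ₗ? vertices p) (λ x∉p → blocked (x , x∈W , wx , x∉p))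

    leaf : ∀ {W w} → w ∈ W → Leaf W
    leaf {w = w} w∈W = walk n (path w [] ([] ∷ []) [-] (w∈W ∷ [])) (n<1+n n)

    decompose : ∀ W → Acc _<_ ∣ W ∣ → Decomposition W
    decompose W (acc smaller) with nonempty? W
    ... | no empty = empty-decomposition empty
    ... | yes (_ , w₀∈W) with leaf w₀∈W
    ...   | isolated w w∈W noNeighbour =
      extend-isolated w∈W noNeighbour (decompose (W - w) (smaller (x∈p⇒∣p-x∣<∣p∣ w∈W)))
    ...   | pendant w w′ w∈W w′∈W ww′ onlyNeighbour =
      extend-pendant w∈W w′∈W ww′ onlyNeighbour
        (decompose (W - w - w′)
          (smaller (<-trans (x∈p⇒∣p-x∣<∣p∣ (neighbour-survives ww′ w′∈W)) (x∈p⇒∣p-x∣<∣p∣ w∈W))))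

    forest-decomposition : ∀ W → Decomposition W
    forest-decomposition W = decompose W (<-wellFounded ∣ W ∣)

module _ {n : ℕ} (G : Graph n) where

  consecutive-related : ∀ {R : Fin n → Fin n → Set} {xs u w} → Linked R xs → Consec G xs u w →
                        R u w ⊎ R w u
  consecutive-related {xs = _ ∷ _ ∷ _} (r ∷ _)      (inj₁ (inj₁ (refl , refl))) = inj₁ r
  consecutive-related {xs = _ ∷ _ ∷ _} (r ∷ _)      (inj₁ (inj₂ (refl , refl))) = inj₂ r
  consecutive-related {xs = _ ∷ _ ∷ _} (_ ∷ linked) (inj₂ later)                 = consecutive-related linked later

  successor : ∀ {v xs s} → Any (v ≡_) xs → Linked (Adj G) (xs ++ [ s ]) →
              ∃[ y ] Adj G v y × Consec G (xs ++ [ s ]) v y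
  successor {xs = _ ∷ []}    (here refl) (r ∷ [-])    = _ , r , inj₁ (inj₁ (refl , refl))
  successor {xs = _ ∷ _ ∷ _} (here refl) (r ∷ _)      = _ , r , inj₁ (inj₁ (refl , refl))
  successor {xs = _ ∷ _ ∷ _} (there v∈)  (_ ∷ linked) = Product.map₂ (Product.map₂ inj₂) (successor v∈ linked)

module _ {n : ℕ} (G : Graph n) (v y : Fin n) where

  IsVY : Fin n → Fin n → Set
  IsVY a b = (a ≡ v × b ≡ y) ⊎ (a ≡ y × b ≡ v)

  isVY? : ∀ a b → Dec (IsVY a b)
  isVY? a b = (a ≟ v ×-dec b ≟ y) ⊎-dec (a ≟ y ×-dec b ≟ v)

  IsVY-swap : ∀ {a b} → IsVY a b → IsVY b a
  IsVY-swap = Sum.swap ∘ Sum.map Product.swap Product.swap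

  deleteEdge : Graph n
  deleteEdge = record
    { adj    = λ a b → adj G a b ∧ not (does (isVY? a b))
    ; sym    = λ a b → cong₂ _∧_ (adj-sym G a b)
                         (cong not (does-⇔ (mk⇔ IsVY-swap IsVY-swap) (isVY? a b) (isVY? b a)))
    ; irrefl = λ a → cong (_∧ _) (irrefl G a) }

  deleteEdge⁻ : ∀ {a b} → Adj deleteEdge a b → Adj G a b × ¬ IsVY a b
  deleteEdge⁻ {a} {b} ab with Equivalence.to T-∧ ab
  ... | ab∈G , notVY = ab∈G , λ isVY →
    contradiction (trans (sym (dec-true (isVY? a b) isVY)) (Equivalence.to T-not-≡ notVY)) λ ()

  deleteEdge-⊆ : ∀ {a b} → Adj deleteEdge a b → Adj G a b
  deleteEdge-⊆ = proj₁ ∘ deleteEdge⁻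

  deleteEdge⁺ : ∀ {a b} → Adj G a b → ¬ IsVY a b → Adj deleteEdge a b
  deleteEdge⁺ {a} {b} ab notVY =
    Equivalence.from T-∧ (ab , Equivalence.from T-not-≡ (dec-false (isVY? a b) notVY))

  independent-restore : ∀ {S x} → Independent deleteEdge S → x ≡ v ⊎ x ≡ y → x ∉ S →
                        Independent G S
  independent-restore ind endpoint x∉S a b a∈S b∈S ab with isVY? a b | endpoint
  ... | no notVY                 | _         = ind a b a∈S b∈S (deleteEdge⁺ ab notVY)
  ... | yes (inj₁ (refl , refl)) | inj₁ refl = x∉S a∈S
  ... | yes (inj₁ (refl , refl)) | inj₂ refl = x∉S b∈S
  ... | yes (inj₂ (refl , refl)) | inj₁ refl = x∉S b∈S
  ... | yes (inj₂ (refl , refl)) | inj₂ refl = x∉S a∈S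

  -- If vy is an edge of the unique cycle C of G, deleting it leaves no
  -- cycle: a cycle of G - vy is a cycle of G, so it has C's edge vy.
  deleteEdge-acyclic : (C : Cycle G) → (∀ D → SameCycle G C D) → CycleEdge G C v y → ¬ Cycle deleteEdge
  deleteEdge-acyclic C unique vy∈C (cycle s r long distinct closed)
    with consecutive-related G closed
           (proj₁ (unique (cycle s r long distinct (Linked.map deleteEdge-⊆ closed)) v y) vy∈C)
  ... | inj₁ vy = proj₂ (deleteEdge⁻ vy) (inj₁ (refl , refl))
  ... | inj₂ yv = proj₂ (deleteEdge⁻ yv) (inj₂ (refl , refl))

corollary2p6 : (n : ℕ) (G : Graph n) → Unicyclic G → ¬ KonigEgervary G →
               (C : Cycle G) → (∀ D → SameCycle G C D) →
               ∀ v → OnCycle G C v → ¬ InClosedNbhdCore G v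
corollary2p6 n G _ notKE C unique v v∈C with successor G v∈C (Cycle.closed C)
... | y , vy , vy∈C = not-in-N[core]
  where
  H : Graph n
  H = deleteEdge G v y
  open Decomposition (forest-decomposition H (deleteEdge-acyclic G v y C unique vy∈C) ⊤)
  fill : ∣ S ∣ + length M ≡ n
  fill = trans covers (∣⊤∣≡n n)
  matchingG : Matching G M
  matchingG = matching-of-subgraph G {H = H} (deleteEdge-⊆ G v y) matching
  -- S is not independent in G (else G would be König–Egerváry), so it
  -- contains both v and y ...
  in-S : ∀ {x} → x ≡ v ⊎ x ≡ y → x ∈ S
  in-S endpoint = decidable-stable (_ ∈? S) λ x∉S →
    notKE (konig-egervary-witness G {T = S} (independent-restore G v y independent endpoint x∉S) matchingG fill)
  maximum-without : ∀ {x} → x ≡ v ⊎ x ≡ y → MaxIndependent G (S - x)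
  maximum-without {x} endpoint = one-below-is-maximum G notKE {S = S} matchingG fill
    (independent-restore G v y (independent-⊆ H (p-x⊆p S x) independent) endpoint (x∉p-x S x))
    (∣p-x∣+1≡∣p∣ (in-S endpoint))
  not-in-N[core] : ¬ InClosedNbhdCore G v
  not-in-N[core] (inj₁ v∈core) = x∉p-x S v (v∈core (S - v) (maximum-without (inj₁ refl)))
  not-in-N[core] (inj₂ (u , u∈core , uv)) =
    proj₁ S-y-maximum u v (u∈core (S - y) S-y-maximum) v∈S-y uv
    where
    S-y-maximum : MaxIndependent G (S - y)
    S-y-maximum = maximum-without (inj₂ refl)
    v∈S-y : v ∈ S - y
    v∈S-y = x∈p∧x≢y⇒x∈p-y (in-S (inj₁ refl)) λ { refl → Adj-irrefl G vy }
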